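{- For any $\mathsf{F}_{<:}^{\top}$-term $\Theta\vdash^\top t$, if $\Theta\vdash_M t:T$ then $T$ is a minimal type for $\mathsf{F}_{<:}^{\top}$.
   Context: System $\mathsf{F}_{<:}^{K\top}$ types: $T ::= \top \mid X \mid T\to T \mid \forall^{K}(X<:T).T \mid \forall^{\top}(X<:T).T$ (up to $\alpha$-conversion). Raw terms: $t ::= \mathsf{top}\mid x\mid \lambda(x:T).t\mid \Lambda(X<:T).t\mid t\,t\mid t\{T\}$. Contexts are finite sequences of $X<:T$ and $x:T$. Subtyping $\Theta\vdash S<:T$ is generated by Var ($\Theta,X<:T,\Theta'\vdash X<:T$), Top, Refl, Trans, the arrow rule, ($\forall$-Fun) $\forall^K(X<:S).T<:\forall^K(X<:S).T'$ from $\Theta,X<:S\vdash T<:T'$, ($\forall$-Loc) $\forall^K(X<:S_0).S_1<:\forall^\top(X<:T_0).T_1$ from $T_0<:S_0$ and $\Theta,X<:S_0\vdash S_1<:T_1$, and ($\forall$-Top) $\forall^\top(X<:S_0).S_1<:\forall^\top(X<:T_0).T_1$ from $T_0<:S_0$ and $\Theta,X<:\top\vdash S_1<:T_1$. Define $\Theta^*(T)=\Theta^*(S)$ if $T$ is a variable $X$ with $\Theta=\Theta',X<:S,\Theta''$, and $\Theta^*(T)=T$ otherwise. Minimal typing judgments $\Theta\vdash_M t:T$: $\Theta,x:T,\Theta'\vdash_M x:T$; $\Theta\vdash_M\mathsf{top}:\top$; $\Theta\vdash_M\lambda(x:S).t:S\to T$ from $\Theta,x:S\vdash_M t:T$; $\Theta\vdash_M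 r\,s:T$ from $\Theta\vdash_M r:R$, $\Theta\vdash_M s:S$, $\Theta\vdash S<:S'$, where $\Theta^*(R)=S'\to T$; $\Theta\vdash_M\Lambda(X<:S).t:\forall^K(X<:S).T$ from $\Theta,X<:S\vdash_M t:T$; $\Theta\vdash_M r\{S\}:T[S/X]$ from $\Theta\vdash_M r:R$, $\Theta\vdash S<:S'$, where $\Theta^*(R)$ is $\forall^K(X<:S').T$ or $\forall^\top(X<:S').T$. An $\mathsf{F}_{<:}^{\top}$-type is a type with no $\forall^K$. An $\mathsf{F}_{<:}^{\top}$-term $\Theta\vdash^\top t$ is a well-formed context and term whose type annotations (in $\Theta$ and $t$) are all $\mathsf{F}_{<:}^{\top}$-types. The minimal types for $\mathsf{F}_{<:}^{\top}$ are the types generated by $T ::= S\mid\forall^K(X<:S).T\mid S\to T$, where $S$ ranges over $\mathsf{F}_{<:}^{\top}$-types. -}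

module Defs where

open import Data.Nat using (ℕ; zero; suc)
open import Data.Fin using (Fin; zero; suc)
open import Data.Sum using (_⊎_)
open import Relation.Binary.PropositionalEquality using (_≡_)

-- Types of F<:^{K⊤}, intrinsically scoped with de Bruijn indices
-- (so α-equivalence is syntactic equality). Ty n = types with n free
-- type variables.
data Ty (n : ℕ) : Set where
  top  : Ty n
  var  : Fin n → Ty n
  _⇒_  : Ty n → Ty n → Ty n
  allK : Ty n → Ty (suc n) → Ty n
  allT : Ty n → Ty (suc n) → Ty n

infixr 7 _⇒_

ext : ∀ {m n} → (Fin m → Fin n) → Fin (suc m) → Fin (suc n)
ext ρ zero    = zero
ext ρ (suc i) = suc (ρ i)

rename : ∀ {m n} → (Fin m → Fin n) → Ty m → Ty n
rename ρ top        = top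
rename ρ (var X)    = var (ρ X)
rename ρ (S ⇒ T)    = rename ρ S ⇒ rename ρ T
rename ρ (allK S T) = allK (rename ρ S) (rename (ext ρ) T)
rename ρ (allT S T) = allT (rename ρ S) (rename (ext ρ) T)

wk : ∀ {n} → Ty n → Ty (suc n)
wk = rename suc

exts : ∀ {m n} → (Fin m → Ty n) → Fin (suc m) → Ty (suc n)
exts σ zero    = var zero
exts σ (suc i) = wk (σ i)

subst : ∀ {m n} → (Fin m → Ty n) → Ty m → Ty n
subst σ top        = top
subst σ (var X)    = σ X
subst σ (S ⇒ T)    = subst σ S ⇒ subst σ T
subst σ (allK S T) = allK (subst σ S) (subst (exts σ) T)
subst σ (allT S T) = allT (subst σ S) (subst (exts σ) T)

single : ∀ {n} → Ty n → Fin (suc n) → Ty n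
single S zero    = S
single S (suc i) = var i

_[_] : ∀ {n} → Ty (suc n) → Ty n → Ty n
T [ S ] = subst (single S) T

-- Contexts: finite sequences of X <: T and x : T (n = #type variables)
data Ctx : ℕ → Set where
  ∅     : Ctx zero
  _,<:_ : ∀ {n} → Ctx n → Ty n → Ctx (suc n)
  _,∶_  : ∀ {n} → Ctx n → Ty n → Ctx n

bound : ∀ {n} → Ctx n → Fin n → Ty n
bound (Θ ,<: S) zero    = wk S
bound (Θ ,<: S) (suc X) = wk (bound Θ X)
bound (Θ ,∶ S)  X       = bound Θ X

-- Θ*(T): promote a type variable through its bounds until a non-variable
mutual
  expose : ∀ {n} → Ctx n → Ty n → Ty n
  expose Θ (var X) = exposeVar Θ X
  expose Θ T       = T

  exposeVar : ∀ {n} → Ctx n → Fin n → Ty n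
  exposeVar (Θ ,<: S) zero    = wk (expose Θ S)
  exposeVar (Θ ,<: S) (suc X) = wk (exposeVar Θ X)
  exposeVar (Θ ,∶ S)  X       = exposeVar Θ X

-- Raw terms; term variables are de Bruijn indices counting term bindings only
data Tm (n : ℕ) : Set where
  top  : Tm n
  var  : ℕ → Tm n
  lam  : Ty n → Tm n → Tm n
  tlam : Ty n → Tm (suc n) → Tm n
  app  : Tm n → Tm n → Tm n
  tapp : Tm n → Ty n → Tm n

data _∋_∶_ : ∀ {n} → Ctx n → ℕ → Ty n → Set where
  here   : ∀ {n} {Θ : Ctx n} {T} → (Θ ,∶ T) ∋ zero ∶ T
  there  : ∀ {n} {Θ : Ctx n} {x T S} → Θ ∋ x ∶ T → (Θ ,∶ S) ∋ suc x ∶ T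
  tthere : ∀ {n} {Θ : Ctx n} {x T S} → Θ ∋ x ∶ T → (Θ ,<: S) ∋ x ∶ wk T

data _⊢_<:_ : ∀ {n} → Ctx n → Ty n → Ty n → Set where
  s-var   : ∀ {n} {Θ : Ctx n} {X} → Θ ⊢ var X <: bound Θ X
  s-top   : ∀ {n} {Θ : Ctx n} {S} → Θ ⊢ S <: top
  s-refl  : ∀ {n} {Θ : Ctx n} {S} → Θ ⊢ S <: S
  s-trans : ∀ {n} {Θ : Ctx n} {S U T} → Θ ⊢ S <: U → Θ ⊢ U <: T → Θ ⊢ S <: T
  s-arr   : ∀ {n} {Θ : Ctx n} {S₀ S₁ T₀ T₁} →
            Θ ⊢ T₀ <: S₀ → Θ ⊢ S₁ <: T₁ → Θ ⊢ (S₀ ⇒ S₁) <: (T₀ ⇒ T₁)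
  s-allFun : ∀ {n} {Θ : Ctx n} {S T T'} →
             (Θ ,<: S) ⊢ T <: T' → Θ ⊢ allK S T <: allK S T'
  s-allLoc : ∀ {n} {Θ : Ctx n} {S₀ S₁ T₀ T₁} →
             Θ ⊢ T₀ <: S₀ → (Θ ,<: S₀) ⊢ S₁ <: T₁ → Θ ⊢ allK S₀ S₁ <: allT T₀ T₁
  s-allTop : ∀ {n} {Θ : Ctx n} {S₀ S₁ T₀ T₁} →
             Θ ⊢ T₀ <: S₀ → (Θ ,<: top) ⊢ S₁ <: T₁ → Θ ⊢ allT S₀ S₁ <: allT T₀ T₁

data _⊢M_∶_ : ∀ {n} → Ctx n → Tm n → Ty n → Set where
  m-var  : ∀ {n} {Θ : Ctx n} {x T} → Θ ∋ x ∶ T → Θ ⊢M var x ∶ T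
  m-top  : ∀ {n} {Θ : Ctx n} → Θ ⊢M top ∶ top
  m-lam  : ∀ {n} {Θ : Ctx n} {S t T} → (Θ ,∶ S) ⊢M t ∶ T → Θ ⊢M lam S t ∶ (S ⇒ T)
  m-app  : ∀ {n} {Θ : Ctx n} {r s R S S' T} →
           Θ ⊢M r ∶ R → Θ ⊢M s ∶ S → Θ ⊢ S <: S' → expose Θ R ≡ (S' ⇒ T) →
           Θ ⊢M app r s ∶ T
  m-tlam : ∀ {n} {Θ : Ctx n} {S t T} → (Θ ,<: S) ⊢M t ∶ T → Θ ⊢M tlam S t ∶ allK S T
  m-tapp : ∀ {n} {Θ : Ctx n} {r S R S' T} →
           Θ ⊢M r ∶ R → Θ ⊢ S <: S' →
           (expose Θ R ≡ allK S' T ⊎ expose Θ R ≡ allT S' T) →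
           Θ ⊢M tapp r S ∶ (T [ S ])

data TopTy : ∀ {n} → Ty n → Set where
  tt-top : ∀ {n} → TopTy {n} top
  tt-var : ∀ {n} {X : Fin n} → TopTy (var X)
  tt-arr : ∀ {n} {S T : Ty n} → TopTy S → TopTy T → TopTy (S ⇒ T)
  tt-all : ∀ {n} {S : Ty n} {T} → TopTy S → TopTy T → TopTy (allT S T)

data TopCtx : ∀ {n} → Ctx n → Set where
  tc-∅   : TopCtx ∅
  tc-<:  : ∀ {n} {Θ : Ctx n} {T} → TopCtx Θ → TopTy T → TopCtx (Θ ,<: T)
  tc-∶   : ∀ {n} {Θ : Ctx n} {T} → TopCtx Θ → TopTy T → TopCtx (Θ ,∶ T)

data TopTm : ∀ {n} → Tm n → Set where
  tm-top  : ∀ {n} → TopTm {n} top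
  tm-var  : ∀ {n} {x} → TopTm {n} (var x)
  tm-lam  : ∀ {n} {T : Ty n} {t} → TopTy T → TopTm t → TopTm (lam T t)
  tm-tlam : ∀ {n} {T : Ty n} {t} → TopTy T → TopTm t → TopTm (tlam T t)
  tm-app  : ∀ {n} {r s : Tm n} → TopTm r → TopTm s → TopTm (app r s)
  tm-tapp : ∀ {n} {r : Tm n} {T} → TopTm r → TopTy T → TopTm (tapp r T)

data MinTy : ∀ {n} → Ty n → Set where
  mt-base : ∀ {n} {S : Ty n} → TopTy S → MinTy S
  mt-allK : ∀ {n} {S : Ty n} {T} → TopTy S → MinTy T → MinTy (allK S T)
  mt-arr  : ∀ {n} {S T : Ty n} → TopTy S → MinTy T → MinTy (S ⇒ T)

module Submission where

-- An F<:^⊤ context only ever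
-- binds F<:^⊤-types, and these are closed under renaming, substitution and
-- promotion Θ*; so the function type Θ*(R) of an application or type
-- application is still minimal, its result or body is minimal, and
-- instantiating that body with an F<:^⊤-type keeps it minimal.

open import Defs
open import Data.Fin using (Fin; zero; suc)
open import Data.Sum using (_⊎_; inj₁; inj₂)
open import Relation.Binary.PropositionalEquality using (_≡_; refl)

TopTy-rename : ∀ {m n} (ρ : Fin m → Fin n) {T} → TopTy T → TopTy (rename ρ T)
TopTy-rename ρ tt-top       = tt-top
TopTy-rename ρ tt-var       = tt-var
TopTy-rename ρ (tt-arr S T) = tt-arr (TopTy-rename ρ S) (TopTy-rename ρ T)
TopTy-rename ρ (tt-all S T) = tt-all (TopTy-rename ρ S) (TopTy-rename (ext ρ) T)

TopSubst : ∀ {m n} → (Fin m → Ty n) → Set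
TopSubst {m} σ = (i : Fin m) → TopTy (σ i)

TopSubst-exts : ∀ {m n} {σ : Fin m → Ty n} → TopSubst σ → TopSubst (exts σ)
TopSubst-exts σ⊤ zero    = tt-var
TopSubst-exts σ⊤ (suc i) = TopTy-rename suc (σ⊤ i)

TopSubst-single : ∀ {n} {S : Ty n} → TopTy S → TopSubst (single S)
TopSubst-single S⊤ zero    = S⊤
TopSubst-single S⊤ (suc i) = tt-var

TopTy-subst : ∀ {m n} {σ : Fin m → Ty n} → TopSubst σ → ∀ {T} → TopTy T → TopTy (subst σ T)
TopTy-subst σ⊤ tt-top           = tt-top
TopTy-subst σ⊤ (tt-var {X = X}) = σ⊤ X
TopTy-subst σ⊤ (tt-arr S T)     = tt-arr (TopTy-subst σ⊤ S) (TopTy-subst σ⊤ T)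
TopTy-subst σ⊤ (tt-all S T)     = tt-all (TopTy-subst σ⊤ S) (TopTy-subst (TopSubst-exts σ⊤) T)

MinTy-subst : ∀ {m n} {σ : Fin m → Ty n} → TopSubst σ → ∀ {T} → MinTy T → MinTy (subst σ T)
MinTy-subst σ⊤ (mt-base T)   = mt-base (TopTy-subst σ⊤ T)
MinTy-subst σ⊤ (mt-allK S T) = mt-allK (TopTy-subst σ⊤ S) (MinTy-subst (TopSubst-exts σ⊤) T)
MinTy-subst σ⊤ (mt-arr S T)  = mt-arr (TopTy-subst σ⊤ S) (MinTy-subst σ⊤ T)

mutual
  TopTy-expose : ∀ {n} {Θ : Ctx n} → TopCtx Θ → ∀ {T} → TopTy T → TopTy (expose Θ T)
  TopTy-expose Θ⊤ tt-top           = tt-top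
  TopTy-expose Θ⊤ (tt-var {X = X}) = TopTy-exposeVar Θ⊤ X
  TopTy-expose Θ⊤ (tt-arr S T)     = tt-arr S T
  TopTy-expose Θ⊤ (tt-all S T)     = tt-all S T

  TopTy-exposeVar : ∀ {n} {Θ : Ctx n} → TopCtx Θ → (X : Fin n) → TopTy (exposeVar Θ X)
  TopTy-exposeVar (tc-<: Θ⊤ S) zero    = TopTy-rename suc (TopTy-expose Θ⊤ S)
  TopTy-exposeVar (tc-<: Θ⊤ S) (suc X) = TopTy-rename suc (TopTy-exposeVar Θ⊤ X)
  TopTy-exposeVar (tc-∶ Θ⊤ S)  X       = TopTy-exposeVar Θ⊤ X

MinTy-expose : ∀ {n} {Θ : Ctx n} → TopCtx Θ → ∀ {T} → MinTy T → MinTy (expose Θ T)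
MinTy-expose Θ⊤ (mt-base (tt-var {X = X})) = mt-base (TopTy-exposeVar Θ⊤ X)
MinTy-expose Θ⊤ T@(mt-base tt-top)         = T
MinTy-expose Θ⊤ T@(mt-base (tt-arr _ _))   = T
MinTy-expose Θ⊤ T@(mt-base (tt-all _ _))   = T
MinTy-expose Θ⊤ T@(mt-allK _ _)            = T
MinTy-expose Θ⊤ T@(mt-arr _ _)             = T

TopTy-lookup : ∀ {n} {Θ : Ctx n} {x T} → TopCtx Θ → Θ ∋ x ∶ T → TopTy T
TopTy-lookup (tc-∶ Θ⊤ S)  here      = S
TopTy-lookup (tc-∶ Θ⊤ S)  (there x) = TopTy-lookup Θ⊤ x
TopTy-lookup (tc-<: Θ⊤ S) (tthere x) = TopTy-rename suc (TopTy-lookup Θ⊤ x)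

MinTy-⇒⁻ : ∀ {n} {R S T : Ty n} → MinTy R → R ≡ (S ⇒ T) → MinTy T
MinTy-⇒⁻ (mt-base (tt-arr _ T)) refl = mt-base T
MinTy-⇒⁻ (mt-arr _ T)           refl = T

MinTy-∀⁻ : ∀ {n} {R S : Ty n} {T} → MinTy R → R ≡ allK S T ⊎ R ≡ allT S T → MinTy T
MinTy-∀⁻ (mt-allK _ T)          (inj₁ refl) = T
MinTy-∀⁻ (mt-base (tt-all _ T)) (inj₂ refl) = mt-base T

mainTheorem14 : ∀ {n} (Θ : Ctx n) (t : Tm n) (T : Ty n) →
    TopCtx Θ → TopTm t → Θ ⊢M t ∶ T → MinTy T
mainTheorem14 _ _ _ Θ⊤ t⊤ (m-var x) = mt-base (TopTy-lookup Θ⊤ x)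
mainTheorem14 _ _ _ Θ⊤ t⊤ m-top     = mt-base tt-top
mainTheorem14 _ _ _ Θ⊤ (tm-lam S t⊤) (m-lam t) =
  mt-arr S (mainTheorem14 _ _ _ (tc-∶ Θ⊤ S) t⊤ t)
mainTheorem14 _ _ _ Θ⊤ (tm-tlam S t⊤) (m-tlam t) =
  mt-allK S (mainTheorem14 _ _ _ (tc-<: Θ⊤ S) t⊤ t)
mainTheorem14 _ _ _ Θ⊤ (tm-app r⊤ _) (m-app r _ _ Θ*R≡S⇒T) =
  MinTy-⇒⁻ (MinTy-expose Θ⊤ (mainTheorem14 _ _ _ Θ⊤ r⊤ r)) Θ*R≡S⇒T
mainTheorem14 _ _ _ Θ⊤ (tm-tapp r⊤ S) (m-tapp r _ Θ*R≡∀) =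
  MinTy-subst (TopSubst-single S)
    (MinTy-∀⁻ (MinTy-expose Θ⊤ (mainTheorem14 _ _ _ Θ⊤ r⊤ r)) Θ*R≡∀)
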